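{- Suppose $n,m,k \in \mathbb{N}$, $G=K_{n,m}$, and $L$ is a $k$-assignment for $G$ such that $\eta(c) \leq k$ for each color $c \in \mathcal{L}$. Then there is a proportional $L$-coloring of $G$.
   Context: All graphs are finite and simple; $\mathbb{N}=\{1,2,3,\ldots\}$. $K_{n,m}$ is the complete bipartite graph with partite sets of sizes $n$ and $m$. A list assignment $L$ for $G$ assigns to each vertex $v$ a set $L(v)$ of colors; it is a $k$-assignment if $|L(v)|=k$ for all $v$. The palette is $\mathcal{L}=\bigcup_{v}L(v)$. A proper $L$-coloring is a proper coloring $f$ with $f(v)\in L(v)$ for all $v$. For $c\in\mathcal{L}$, $\eta(c)$ is the number of vertices $v$ with $c\in L(v)$. If $L$ is a $k$-assignment, a proper $L$-coloring $f$ is a proportional $L$-coloring if for every $c\in\mathcal{L}$, $|f^{ -1}(c)|\in\{\lfloor \eta(c)/k\rfloor,\lceil \eta(c)/k\rceil\}$. -}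

module Defs where

open import Data.Nat using (ℕ; _+_; _∸_; _≤_; NonZero)
open import Data.Nat.Properties using (_≟_)
open import Data.Nat.DivMod using (_/_)
open import Data.Fin using (Fin)
open import Data.Sum using (_⊎_; inj₁; inj₂)
open import Data.Unit using (⊤)
open import Data.Empty using (⊥)
open import Data.Product using (∃)
open import Data.List using (List; map; _++_; filter; length; allFin)
open import Data.List.Membership.Propositional using (_∈_)
open import Data.List.Membership.DecPropositional _≟_ using (_∈?_)
open import Data.List.Relation.Unary.Unique.Propositional using (Unique)
open import Relation.Binary.PropositionalEquality using (_≡_; _≢_)

Color : Set
Color = ℕ

Vertex : ℕ → ℕ → Set
Vertex n m = Fin n ⊎ Fin m

Adj : ∀ {n m} → Vertex n m → Vertex n m → Set
Adj (inj₁ _) (inj₂ _) = ⊤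
Adj (inj₂ _) (inj₁ _) = ⊤
Adj (inj₁ _) (inj₁ _) = ⊥
Adj (inj₂ _) (inj₂ _) = ⊥

vertices : (n m : ℕ) → List (Vertex n m)
vertices n m = map inj₁ (allFin n) ++ map inj₂ (allFin m)

-- A list assignment: each vertex gets a finite set of colours (a duplicate-free list).
ListAssignment : ℕ → ℕ → Set
ListAssignment n m = Vertex n m → List Color

IsKAssignment : ∀ {n m} → ℕ → ListAssignment n m → Set
IsKAssignment k L = ∀ v → Unique (L v) × length (L v) ≡ k
  where open import Data.Product using (_×_)

InPalette : ∀ {n m} → ListAssignment n m → Color → Set
InPalette L c = ∃ λ v → c ∈ L v

η : ∀ {n m} → ListAssignment n m → Color → ℕ
η {n} {m} L c = length (filter (λ v → c ∈? L v) (vertices n m))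

IsProperLColoring : ∀ {n m} → ListAssignment n m → (Vertex n m → Color) → Set
IsProperLColoring {n} {m} L f =
  (∀ v → f v ∈ L v) × (∀ u v → Adj {n} {m} u v → f u ≢ f v)
  where open import Data.Product using (_×_)

preimageSize : ∀ {n m} → (Vertex n m → Color) → Color → ℕ
preimageSize {n} {m} f c = length (filter (λ v → f v ≟ c) (vertices n m))

⌈_/_⌉ : ℕ → (k : ℕ) → .{{NonZero k}} → ℕ
⌈ a / k ⌉ = (a + (k ∸ 1)) / k

IsProportionalLColoring : ∀ {n m} (k : ℕ) .{{_ : NonZero k}} →
  ListAssignment n m → (Vertex n m → Color) → Set
IsProportionalLColoring k L f =
  IsProperLColoring L f ×
  (∀ c → InPalette L c →
     (preimageSize f c ≡ η L c / k) ⊎ (preimageSize f c ≡ ⌈ η L c / k ⌉))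
  where open import Data.Product using (_×_)

-- If η(c) ≤ k for all c, a proportional L-colouring must use a colour c at most once
-- when η(c) < k and exactly once when η(c) = k.  It therefore suffices to pick pairwise
-- distinct colours f(v) ∈ L(v) using every colour with η(c) = k; distinct colours make
-- f proper.  Encode L as an incidence matrix I between vertices and colours, with k ones
-- in every row and at most k in every column.  Such a "saturating matching" comes from
-- Hall's theorem applied to a square graph on vertices ⊎ colours, in which vertices see
-- their colours, colours see their vertices and sparse colours (fewer than k vertices)
-- also see themselves: double counting edges verifies Hall's condition, and a perfect
-- matching hits every non-sparse colour from a vertex, as injective endomaps of Fin are
-- surjective.
module Submission where

open import Defs

import Data.Nat.Properties as ℕ
open import Data.Bool using (Bool; true; false; _∧_; _∨_; not; T; T?)
open import Data.Bool.Properties using (T-∧; T-∨; ∨-zeroʳ)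
open import Data.Empty using (⊥)
open import Data.Fin using (Fin; zero; suc; toℕ; fromℕ<; _↑ˡ_; _↑ʳ_; punchIn; punchOut; splitAt; join)
import Data.Fin.Properties as Fin
import Data.Fin.Subset.Properties as BitVector
open import Data.List using (List; []; _∷_; length; filter; map; _++_; tabulate)
import Data.List.Properties as List
open import Data.List.Membership.Propositional using (_∈_)
open import Data.List.Membership.DecPropositional ℕ._≟_ using (_∈?_)
open import Data.List.Relation.Unary.Any using (here; there)
import Data.List.Relation.Unary.All as All
open import Data.List.Relation.Unary.AllPairs using (_∷_)
open import Data.List.Relation.Unary.Unique.Propositional using (Unique)
open import Data.Nat using (ℕ; zero; suc; _+_; _*_; _∸_; _≤_; _<_; z≤n; s≤s; _≤?_; _<?_; NonZero)
open import Data.Nat.DivMod using (_/_; m<n⇒m/n≡0; n/n≡1; m/n≡1+[m∸n]/n)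
import Data.Nat.ListAction as ListAction
open import Data.Product using (Σ; ∃; _×_; _,_; proj₁; proj₂)
open import Data.Sum using (_⊎_; inj₁; inj₂)
open import Data.Sum.Properties using (inj₂-injective)
import Data.Vec as Vec
open import Data.Vec.Properties using (lookup∘tabulate)
open import Function using (id; _∘_; Equivalence)
open import Function.Definitions using (Injective)
open import Relation.Binary.PropositionalEquality
  using (_≡_; _≢_; refl; sym; trans; cong; cong₂; subst; module ≡-Reasoning)
open import Relation.Nullary using (¬_; Dec; yes; no; contradiction; _×-dec_; _→-dec_)
open import Relation.Nullary.Decidable using (⌊_⌋; fromWitness; toWitness)
import Relation.Nullary.Decidable as Dec
open import Relation.Unary using (Decidable)
open import Algebra.Properties.Semiring.Sum ℕ.+-*-semiring
  using (sum; sum-syntax; ∑-distrib-+; ∑-comm; *-distribˡ-sum; sum-cong-≗; sum-replicate-zero; sum-remove)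

∑-mono : ∀ {n} {f g : Fin n → ℕ} → (∀ i → f i ≤ g i) → ∑[ i < n ] f i ≤ ∑[ i < n ] g i
∑-mono {zero} f≤g = z≤n
∑-mono {suc n} f≤g = ℕ.+-mono-≤ (f≤g zero) (∑-mono (f≤g ∘ suc))

∑-zero : ∀ {n} (f : Fin n → ℕ) → (∀ i → f i ≡ 0) → ∑[ i < n ] f i ≡ 0
∑-zero {n} f f≡0 = trans (sum-cong-≗ f≡0) (sum-replicate-zero n)

∑-single : ∀ {n} (f : Fin n → ℕ) (i : Fin n) → (∀ j → j ≢ i → f j ≡ 0) → ∑[ j < n ] f j ≡ f i
∑-single {suc n} f i others = begin
  sum f                         ≡⟨ sum-remove {i = i} f ⟩
  f i + ∑[ j < n ] f (punchIn i j) ≡⟨ cong (f i +_) (∑-zero _ (λ j → others _ (Fin.punchInᵢ≢i i j))) ⟩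
  f i + 0                       ≡⟨ ℕ.+-identityʳ (f i) ⟩
  f i                           ∎
  where open ≡-Reasoning

term≤∑ : ∀ {n} (f : Fin n → ℕ) (i : Fin n) → f i ≤ ∑[ j < n ] f j
term≤∑ f zero = ℕ.m≤m+n _ _
term≤∑ f (suc i) = ℕ.≤-trans (term≤∑ (f ∘ suc) i) (ℕ.m≤n+m _ (f zero))

∑-++ : ∀ m {n} (f : Fin (m + n) → ℕ) →
  ∑[ i < m + n ] f i ≡ ∑[ i < m ] f (i ↑ˡ n) + ∑[ j < n ] f (m ↑ʳ j)
∑-++ zero f = refl
∑-++ (suc m) f = trans (cong (f zero +_) (∑-++ m (f ∘ suc))) (sym (ℕ.+-assoc (f zero) _ _))

Subset : ℕ → Set
Subset n = Fin n → Bool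

infix 4 _⊆_
infixr 7 _∩_
infixr 6 _∪_ _∖_

_⊆_ : ∀ {n} → Subset n → Subset n → Set
S ⊆ R = ∀ i → T (S i) → T (R i)

_∩_ _∪_ _∖_ : ∀ {n} → Subset n → Subset n → Subset n
(S ∩ R) i = S i ∧ R i
(S ∪ R) i = S i ∨ R i
(S ∖ R) i = S i ∧ not (R i)

⁅_⁆ : ∀ {n} → Fin n → Subset n
⁅ i ⁆ j = ⌊ j Fin.≟ i ⌋

∩-intro : ∀ {x y} → T x → T y → T (x ∧ y)
∩-intro p q = Equivalence.from T-∧ (p , q)

∩-elim : ∀ {x y} → T (x ∧ y) → T x × T y
∩-elim = Equivalence.to T-∧

∪-elim : ∀ {x y} → T (x ∨ y) → T x ⊎ T y
∪-elim = Equivalence.to T-∨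

∪-introˡ : ∀ {x y} → T x → T (x ∨ y)
∪-introˡ p = Equivalence.from T-∨ (inj₁ p)

∪-introʳ : ∀ {x y} → T y → T (x ∨ y)
∪-introʳ p = Equivalence.from T-∨ (inj₂ p)

∖-intro : ∀ {x y} → T x → ¬ T y → T (x ∧ not y)
∖-intro {y = true} p ¬q = contradiction _ ¬q
∖-intro {y = false} p ¬q = ∩-intro p _

∖-elim : ∀ {x y} → T (x ∧ not y) → T x × ¬ T y
∖-elim {true} {false} _ = _ , λ ()

⁅⁆-elim : ∀ {n} {i j : Fin n} → T (⁅ i ⁆ j) → j ≡ i
⁅⁆-elim {i = i} {j} = toWitness {a? = j Fin.≟ i}

⁅⁆-intro : ∀ {n} (i : Fin n) → T (⁅ i ⁆ i)
⁅⁆-intro i = fromWitness refl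

⋁ : ∀ {n} → Subset n → Bool
⋁ S = ⌊ Fin.any? (T? ∘ S) ⌋

⋁-intro : ∀ {n} {S : Subset n} i → T (S i) → T (⋁ S)
⋁-intro i p = fromWitness (i , p)

⋁-elim : ∀ {n} {S : Subset n} → T (⋁ S) → ∃ λ i → T (S i)
⋁-elim {S = S} = toWitness {a? = Fin.any? (T? ∘ S)}

𝟙 : Bool → ℕ
𝟙 true = 1
𝟙 false = 0

∣_∣ : ∀ {n} → Subset n → ℕ
∣_∣ {n} S = ∑[ i < n ] 𝟙 (S i)

𝟙-true : ∀ {x} → T x → 𝟙 x ≡ 1
𝟙-true {true} _ = refl

𝟙-false : ∀ {x} → ¬ T x → 𝟙 x ≡ 0
𝟙-false {true} ¬p = contradiction _ ¬p
𝟙-false {false} _ = refl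

𝟙-mono : ∀ {x y} → (T x → T y) → 𝟙 x ≤ 𝟙 y
𝟙-mono {false} _ = z≤n
𝟙-mono {true} x⇒y = ℕ.≤-reflexive (sym (𝟙-true (x⇒y _)))

𝟙-∨ : ∀ x y → 𝟙 (x ∨ y) ≤ 𝟙 x + 𝟙 y
𝟙-∨ true y = ℕ.m≤m+n 1 (𝟙 y)
𝟙-∨ false y = ℕ.≤-refl

𝟙-∨-disjoint : ∀ x y → (T x → T y → ⊥) → 𝟙 (x ∨ y) ≡ 𝟙 x + 𝟙 y
𝟙-∨-disjoint true true disj = contradiction _ (disj _)
𝟙-∨-disjoint true false disj = refl
𝟙-∨-disjoint false y disj = refl

full : ∀ {n} → Subset n
full _ = true

∣full∣ : ∀ n → ∣ full {n} ∣ ≡ n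
∣full∣ zero = refl
∣full∣ (suc n) = cong suc (∣full∣ n)

module _ {n : ℕ} where

  ∣∣-mono : {S R : Subset n} → S ⊆ R → ∣ S ∣ ≤ ∣ R ∣
  ∣∣-mono S⊆R = ∑-mono (λ i → 𝟙-mono (S⊆R i))

  ∣∣-cong : {S R : Subset n} → S ⊆ R → R ⊆ S → ∣ S ∣ ≡ ∣ R ∣
  ∣∣-cong S⊆R R⊆S = ℕ.≤-antisym (∣∣-mono S⊆R) (∣∣-mono R⊆S)

  ∣∪∣≤ : (S R : Subset n) → ∣ S ∪ R ∣ ≤ ∣ S ∣ + ∣ R ∣
  ∣∪∣≤ S R = ℕ.≤-trans (∑-mono (λ i → 𝟙-∨ (S i) (R i)))
                       (ℕ.≤-reflexive (∑-distrib-+ (𝟙 ∘ S) (𝟙 ∘ R)))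

  ∣∪∣-disjoint : {S R : Subset n} → (∀ i → T (S i) → T (R i) → ⊥) → ∣ S ∪ R ∣ ≡ ∣ S ∣ + ∣ R ∣
  ∣∪∣-disjoint {S} {R} disj =
    trans (sum-cong-≗ (λ i → 𝟙-∨-disjoint (S i) (R i) (disj i))) (∑-distrib-+ (𝟙 ∘ S) (𝟙 ∘ R))

  ∣∖∣+∣∣ : {S R : Subset n} → R ⊆ S → ∣ S ∖ R ∣ + ∣ R ∣ ≡ ∣ S ∣
  ∣∖∣+∣∣ {S} {R} R⊆S =
    trans (sym (∣∪∣-disjoint (λ i p → proj₂ (∖-elim p)))) (∣∣-cong ∪⊆S S⊆∪)
    where
    ∪⊆S : (S ∖ R) ∪ R ⊆ S
    ∪⊆S i p with ∪-elim p
    ... | inj₁ q = proj₁ (∖-elim q)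
    ... | inj₂ q = R⊆S i q
    S⊆∪ : S ⊆ (S ∖ R) ∪ R
    S⊆∪ i p with T? (R i)
    ... | yes q = ∪-introʳ q
    ... | no ¬q = ∪-introˡ (∖-intro p ¬q)

  ∣⁅⁆∣ : (i : Fin n) → ∣ ⁅ i ⁆ ∣ ≡ 1
  ∣⁅⁆∣ i = trans (∑-single _ i (λ j j≢i → 𝟙-false (j≢i ∘ ⁅⁆-elim))) (𝟙-true (⁅⁆-intro i))

  member⇒1≤∣∣ : {S : Subset n} (i : Fin n) → T (S i) → 1 ≤ ∣ S ∣
  member⇒1≤∣∣ {S} i p = ℕ.≤-trans (ℕ.≤-reflexive (sym (𝟙-true p))) (term≤∑ (𝟙 ∘ S) i)

  ∣∣-empty : {S : Subset n} → ¬ T (⋁ S) → ∣ S ∣ ≡ 0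
  ∣∣-empty ¬any = ∑-zero _ (λ i → 𝟙-false (¬any ∘ ⋁-intro i))

  witness : {S : Subset n} → 1 ≤ ∣ S ∣ → ∃ λ i → T (S i)
  witness {S} pos with T? (⋁ S)
  ... | yes any = ⋁-elim any
  ... | no ¬any = contradiction (sym (∣∣-empty ¬any)) (ℕ.<⇒≢ pos)

  anySubset? : {P : Subset n → Set} → (∀ {S R} → S ⊆ R → R ⊆ S → P S → P R) →
               (∀ S → Dec (P S)) → Dec (∃ P)
  anySubset? resp P? =
    Dec.map′ (λ (v , pv) → Vec.lookup v , pv)
             (λ (S , pS) → Vec.tabulate S , resp (to-vec S) (from-vec S) pS)
             (BitVector.anySubset? (P? ∘ Vec.lookup))
    where
    to-vec : ∀ S → S ⊆ Vec.lookup (Vec.tabulate S)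
    to-vec S i = subst T (sym (lookup∘tabulate S i))
    from-vec : ∀ S → Vec.lookup (Vec.tabulate S) ⊆ S
    from-vec S i = subst T (lookup∘tabulate S i)

  ∖-⊆ : (S R : Subset n) → S ∖ R ⊆ S
  ∖-⊆ S R i p = proj₁ (∖-elim {S i} p)

  ∩-⊆ʳ : (S R : Subset n) → S ∩ R ⊆ R
  ∩-⊆ʳ S R i p = proj₂ (∩-elim {S i} p)

  ∩∖-disjoint : (S A : Subset n) → ∀ i → T ((S ∩ A) i) → T ((A ∖ S) i) → ⊥
  ∩∖-disjoint S A i p q = proj₂ (∖-elim {A i} q) (proj₁ (∩-elim {S i} p))

  ∩-monoˡ : {X Y : Subset n} (A : Subset n) → X ⊆ Y → X ∩ A ⊆ Y ∩ A
  ∩-monoˡ A X⊆Y i p = let (x , a) = ∩-elim p in ∩-intro (X⊆Y i x) a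

  ∩-split : (X A Y : Subset n) → X ∩ A ⊆ (X ∩ (A ∖ Y)) ∪ Y
  ∩-split X A Y i = pointwise (X i) (A i) (Y i)
    where
    pointwise : ∀ x a y → T (x ∧ a) → T ((x ∧ (a ∧ not y)) ∨ y)
    pointwise true true false _ = _
    pointwise true true true _ = _

  ∪∩-split : (X Y A : Subset n) → (X ∪ Y) ∩ A ⊆ (X ∩ (A ∖ Y)) ∪ (Y ∩ A)
  ∪∩-split X Y A i = pointwise (X i) (Y i) (A i)
    where
    pointwise : ∀ x y a → T ((x ∨ y) ∧ a) → T ((x ∧ (a ∧ not y)) ∨ (y ∧ a))
    pointwise true false true _ = _
    pointwise true true true _ = _
    pointwise false true true _ = _

-- Hall's marriage theorem for a bipartite relation E between Fin p and Fin q.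
module Hall {p q : ℕ} (E : Fin p → Fin q → Bool) where

  Γ⟨_⟩ : Subset p → Subset q
  Γ⟨ S ⟩ c = ⋁ (λ i → S i ∧ E i c)

  Γ-intro : ∀ {S i c} → T (S i) → T (E i c) → T (Γ⟨ S ⟩ c)
  Γ-intro {i = i} s e = ⋁-intro i (∩-intro s e)

  Γ-elim : ∀ {S c} → T (Γ⟨ S ⟩ c) → ∃ λ i → T (S i) × T (E i c)
  Γ-elim n with ⋁-elim n
  ... | i , p = i , ∩-elim p

  Γ-mono : ∀ {S R} → S ⊆ R → Γ⟨ S ⟩ ⊆ Γ⟨ R ⟩
  Γ-mono S⊆R c n with Γ-elim n
  ... | i , s , e = Γ-intro (S⊆R i s) e

  Γ-∪ : ∀ S R → Γ⟨ S ∪ R ⟩ ⊆ Γ⟨ S ⟩ ∪ Γ⟨ R ⟩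
  Γ-∪ S R c n with Γ-elim n
  ... | i , s∪r , e with ∪-elim s∪r
  ...   | inj₁ s = ∪-introˡ (Γ-intro s e)
  ...   | inj₂ r = ∪-introʳ (Γ-intro r e)

  HallCondition : Subset p → Subset q → Set
  HallCondition D A = ∀ S → S ⊆ D → ∣ S ∣ ≤ ∣ Γ⟨ S ⟩ ∩ A ∣

  record Matching (D : Subset p) (A : Subset q) : Set where
    field
      partner : ∀ i → T (D i) → Fin q
      edge : ∀ i d → T (E i (partner i d))
      inside : ∀ i d → T (A (partner i d))
      injective : ∀ i j d d' → partner i d ≡ partner j d' → i ≡ j

  emptyMatching : ∀ {D A} → (∀ i → ¬ T (D i)) → Matching D A
  emptyMatching empty = record
    { partner = λ i d → contradiction d (empty i)
    ; edge = λ i d → contradiction d (empty i)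
    ; inside = λ i d → contradiction d (empty i)
    ; injective = λ i j d _ _ → contradiction d (empty i)
    }

  singleMatching : ∀ {i₀ c₀} → T (E i₀ c₀) → Matching ⁅ i₀ ⁆ ⁅ c₀ ⁆
  singleMatching {i₀} {c₀} e = record
    { partner = λ _ _ → c₀
    ; edge = λ i d → subst (λ j → T (E j c₀)) (sym (⁅⁆-elim d)) e
    ; inside = λ _ _ → ⁅⁆-intro c₀
    ; injective = λ i j d d' _ → trans (⁅⁆-elim d) (sym (⁅⁆-elim d'))
    }

  combine : ∀ {D A} S A₁ A₂ → S ⊆ D → A₁ ⊆ A → A₂ ⊆ A → (∀ c → T (A₁ c) → T (A₂ c) → ⊥) →
            Matching S A₁ → Matching (D ∖ S) A₂ → Matching D A
  combine {D} {A} S A₁ A₂ S⊆D A₁⊆A A₂⊆A disjoint M₁ M₂ = record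
    { partner = λ i d → pick i d (T? (S i))
    ; edge = λ i d → pick-edge i d (T? (S i))
    ; inside = λ i d → pick-inside i d (T? (S i))
    ; injective = λ i j d d' → pick-injective i j d d' (T? (S i)) (T? (S j))
    }
    where
    module M₁ = Matching M₁
    module M₂ = Matching M₂
    pick : ∀ i → T (D i) → Dec (T (S i)) → Fin q
    pick i d (yes s) = M₁.partner i s
    pick i d (no ¬s) = M₂.partner i (∖-intro d ¬s)
    pick-edge : ∀ i d s? → T (E i (pick i d s?))
    pick-edge i d (yes s) = M₁.edge i s
    pick-edge i d (no ¬s) = M₂.edge i _
    pick-inside : ∀ i d s? → T (A (pick i d s?))
    pick-inside i d (yes s) = A₁⊆A _ (M₁.inside i s)
    pick-inside i d (no ¬s) = A₂⊆A _ (M₂.inside i _)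
    pick-injective : ∀ i j d d' s? s?' → pick i d s? ≡ pick j d' s?' → i ≡ j
    pick-injective i j d d' (yes s) (yes s') eq = M₁.injective i j s s' eq
    pick-injective i j d d' (no ¬s) (no ¬s') eq = M₂.injective i j _ _ eq
    pick-injective i j d d' (yes s) (no ¬s') eq =
      contradiction (subst (T ∘ A₂) (sym eq) (M₂.inside j _)) (disjoint _ (M₁.inside i s))
    pick-injective i j d d' (no ¬s) (yes s') eq =
      contradiction (subst (T ∘ A₂) eq (M₂.inside i _)) (disjoint _ (M₁.inside j s'))

  Solvable : ℕ → Set
  Solvable n = ∀ D A → ∣ D ∣ ≤ n → HallCondition D A → Matching D A

  Critical : Subset p → Subset q → Subset p → Set
  Critical D A S = S ⊆ D × 1 ≤ ∣ S ∣ × ∣ S ∣ < ∣ D ∣ × ∣ Γ⟨ S ⟩ ∩ A ∣ ≤ ∣ S ∣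

  -- Being critical is decidable and invariant under mutual inclusion, so the
  -- existence of a critical set can be decided by exhaustive search.
  critical? : ∀ D A S → Dec (Critical D A S)
  critical? D A S = Fin.all? (λ i → T? (S i) →-dec T? (D i)) ×-dec 1 ≤? ∣ S ∣
                    ×-dec ∣ S ∣ <? ∣ D ∣ ×-dec ∣ Γ⟨ S ⟩ ∩ A ∣ ≤? ∣ S ∣

  critical-resp : ∀ {D A S R} → S ⊆ R → R ⊆ S → Critical D A S → Critical D A R
  critical-resp {D} {A} {S} {R} S⊆R R⊆S (S⊆D , nonempty , proper , tight) =
    (λ i → S⊆D i ∘ R⊆S i) ,
    subst (1 ≤_) ∣S∣≡∣R∣ nonempty ,
    subst (_< ∣ D ∣) ∣S∣≡∣R∣ proper ,
    ℕ.≤-trans (∣∣-mono (∩-monoˡ A (Γ-mono R⊆S))) (subst (_ ≤_) ∣S∣≡∣R∣ tight)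
    where
    ∣S∣≡∣R∣ : ∣ S ∣ ≡ ∣ R ∣
    ∣S∣≡∣R∣ = ∣∣-cong S⊆R R⊆S

  shrink : ∀ {n} (D S : Subset p) → S ⊆ D → 1 ≤ ∣ S ∣ → ∣ D ∣ ≤ suc n → ∣ D ∖ S ∣ ≤ n
  shrink {n} D S S⊆D nonempty size = ℕ.≤-pred (begin
    suc ∣ D ∖ S ∣      ≡⟨ ℕ.+-comm 1 _ ⟩
    ∣ D ∖ S ∣ + 1      ≤⟨ ℕ.+-monoʳ-≤ ∣ D ∖ S ∣ nonempty ⟩
    ∣ D ∖ S ∣ + ∣ S ∣  ≡⟨ ∣∖∣+∣∣ {S = D} S⊆D ⟩
    ∣ D ∣              ≤⟨ size ⟩
    suc n              ∎)
    where open ℕ.≤-Reasoning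

  -- First case of the induction: a critical set S splits the problem into matching S
  -- into its admissible neighbourhood, and D ∖ S into the remaining targets.
  splitCritical : ∀ n {D A} → Solvable n → ∣ D ∣ ≤ suc n → HallCondition D A →
                  ∀ S → Critical D A S → Matching D A
  splitCritical n {D} {A} solve size hallD S (S⊆D , nonempty , proper , tight) =
    combine S (Γ⟨ S ⟩ ∩ A) (A ∖ Γ⟨ S ⟩) S⊆D
      (∩-⊆ʳ Γ⟨ S ⟩ A) (∖-⊆ A Γ⟨ S ⟩) (∩∖-disjoint Γ⟨ S ⟩ A)
      (solve S (Γ⟨ S ⟩ ∩ A) (ℕ.≤-pred (ℕ.≤-trans proper size)) hallS)
      (solve (D ∖ S) (A ∖ Γ⟨ S ⟩) (shrink D S S⊆D nonempty size) hallRest)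
    where
    hallS : HallCondition S (Γ⟨ S ⟩ ∩ A)
    hallS R R⊆S = ℕ.≤-trans (hallD R (λ i → S⊆D i ∘ R⊆S i)) (∣∣-mono Γ⟨R⟩∩A⊆)
      where
      Γ⟨R⟩∩A⊆ : Γ⟨ R ⟩ ∩ A ⊆ Γ⟨ R ⟩ ∩ (Γ⟨ S ⟩ ∩ A)
      Γ⟨R⟩∩A⊆ c p = let (n , a) = ∩-elim p in ∩-intro n (∩-intro (Γ-mono R⊆S c n) a)
    hallRest : HallCondition (D ∖ S) (A ∖ Γ⟨ S ⟩)
    hallRest R R⊆D∖S = ℕ.+-cancelʳ-≤ ∣ S ∣ ∣ R ∣ _ (begin
      ∣ R ∣ + ∣ S ∣
        ≡⟨ ∣∪∣-disjoint {S = R} R∩S=∅ ⟨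
      ∣ R ∪ S ∣
        ≤⟨ hallD (R ∪ S) R∪S⊆D ⟩
      ∣ Γ⟨ R ∪ S ⟩ ∩ A ∣
        ≤⟨ ∣∣-mono Γ⟨R∪S⟩∩A⊆ ⟩
      ∣ (Γ⟨ R ⟩ ∩ (A ∖ Γ⟨ S ⟩)) ∪ (Γ⟨ S ⟩ ∩ A) ∣
        ≤⟨ ∣∪∣≤ (Γ⟨ R ⟩ ∩ (A ∖ Γ⟨ S ⟩)) (Γ⟨ S ⟩ ∩ A) ⟩
      ∣ Γ⟨ R ⟩ ∩ (A ∖ Γ⟨ S ⟩) ∣ + ∣ Γ⟨ S ⟩ ∩ A ∣
        ≤⟨ ℕ.+-monoʳ-≤ _ tight ⟩
      ∣ Γ⟨ R ⟩ ∩ (A ∖ Γ⟨ S ⟩) ∣ + ∣ S ∣ ∎)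
      where
      open ℕ.≤-Reasoning
      R∩S=∅ : ∀ i → T (R i) → T (S i) → ⊥
      R∩S=∅ i r = proj₂ (∖-elim (R⊆D∖S i r))
      R∪S⊆D : R ∪ S ⊆ D
      R∪S⊆D i p with ∪-elim p
      ... | inj₁ r = proj₁ (∖-elim (R⊆D∖S i r))
      ... | inj₂ s = S⊆D i s
      Γ⟨R∪S⟩∩A⊆ : Γ⟨ R ∪ S ⟩ ∩ A ⊆ (Γ⟨ R ⟩ ∩ (A ∖ Γ⟨ S ⟩)) ∪ (Γ⟨ S ⟩ ∩ A)
      Γ⟨R∪S⟩∩A⊆ c p = ∪∩-split Γ⟨ R ⟩ Γ⟨ S ⟩ A c (∩-monoˡ A (Γ-∪ R S) c p)

  admissibleNeighbour : ∀ {D A i₀} → HallCondition D A → ⁅ i₀ ⁆ ⊆ D → ∃ λ c → T (E i₀ c) × T (A c)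
  admissibleNeighbour {D} {A} {i₀} hallD ⁅i₀⁆⊆D
    with witness (subst (_≤ ∣ Γ⟨ ⁅ i₀ ⁆ ⟩ ∩ A ∣) (∣⁅⁆∣ i₀) (hallD ⁅ i₀ ⁆ ⁅i₀⁆⊆D))
  ... | c , p with ∩-elim {Γ⟨ ⁅ i₀ ⁆ ⟩ c} p
  ...   | n , a with Γ-elim n
  ...     | i , i≡i₀ , e = c , subst (λ j → T (E j c)) (⁅⁆-elim i≡i₀) e , a

  -- Second case of the induction: without critical sets, any edge i₀ — c₀ can be
  -- used, and Hall's condition survives deleting i₀ and c₀.
  removeEdge : ∀ n {D A} → Solvable n → ∣ D ∣ ≤ suc n → HallCondition D A →
               ∀ i₀ → T (D i₀) → (∀ S → ¬ Critical D A S) → Matching D A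
  removeEdge n {D} {A} solve size hallD i₀ d₀ noCritical =
    combine ⁅ i₀ ⁆ ⁅ c₀ ⁆ (A ∖ ⁅ c₀ ⁆) ⁅i₀⁆⊆D ⁅c₀⁆⊆A (∖-⊆ A ⁅ c₀ ⁆) c₀∉A∖c₀
      (singleMatching i₀—c₀)
      (solve (D ∖ ⁅ i₀ ⁆) (A ∖ ⁅ c₀ ⁆)
         (shrink D ⁅ i₀ ⁆ ⁅i₀⁆⊆D (ℕ.≤-reflexive (sym (∣⁅⁆∣ i₀))) size) hallRest)
    where
    ⁅i₀⁆⊆D : ⁅ i₀ ⁆ ⊆ D
    ⁅i₀⁆⊆D i p = subst (T ∘ D) (sym (⁅⁆-elim p)) d₀
    neighbour : ∃ λ c → T (E i₀ c) × T (A c)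
    neighbour = admissibleNeighbour hallD ⁅i₀⁆⊆D
    c₀ : Fin q
    c₀ = proj₁ neighbour
    i₀—c₀ : T (E i₀ c₀)
    i₀—c₀ = proj₁ (proj₂ neighbour)
    ⁅c₀⁆⊆A : ⁅ c₀ ⁆ ⊆ A
    ⁅c₀⁆⊆A c p = subst (T ∘ A) (sym (⁅⁆-elim p)) (proj₂ (proj₂ neighbour))
    c₀∉A∖c₀ : ∀ c → T (⁅ c₀ ⁆ c) → T ((A ∖ ⁅ c₀ ⁆) c) → ⊥
    c₀∉A∖c₀ c p q = proj₂ (∖-elim {A c} q) p
    hallRest : HallCondition (D ∖ ⁅ i₀ ⁆) (A ∖ ⁅ c₀ ⁆)
    hallRest R R⊆D∖i₀ with 1 ≤? ∣ R ∣
    ... | no empty = ℕ.≤-trans (ℕ.≮⇒≥ empty) z≤n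
    ... | yes nonempty = ℕ.≤-pred (begin
      suc ∣ R ∣
        ≤⟨ ℕ.≰⇒> (noCritical R ∘ (R⊆D ,_) ∘ (nonempty ,_) ∘ (proper ,_)) ⟩
      ∣ Γ⟨ R ⟩ ∩ A ∣
        ≤⟨ ∣∣-mono (∩-split Γ⟨ R ⟩ A ⁅ c₀ ⁆) ⟩
      ∣ (Γ⟨ R ⟩ ∩ (A ∖ ⁅ c₀ ⁆)) ∪ ⁅ c₀ ⁆ ∣
        ≤⟨ ∣∪∣≤ (Γ⟨ R ⟩ ∩ (A ∖ ⁅ c₀ ⁆)) ⁅ c₀ ⁆ ⟩
      ∣ Γ⟨ R ⟩ ∩ (A ∖ ⁅ c₀ ⁆) ∣ + ∣ ⁅ c₀ ⁆ ∣
        ≡⟨ cong (∣ Γ⟨ R ⟩ ∩ (A ∖ ⁅ c₀ ⁆) ∣ +_) (∣⁅⁆∣ c₀) ⟩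
      ∣ Γ⟨ R ⟩ ∩ (A ∖ ⁅ c₀ ⁆) ∣ + 1
        ≡⟨ ℕ.+-comm _ 1 ⟩
      suc ∣ Γ⟨ R ⟩ ∩ (A ∖ ⁅ c₀ ⁆) ∣ ∎)
      where
      open ℕ.≤-Reasoning
      R⊆D : R ⊆ D
      R⊆D i r = ∖-⊆ D ⁅ i₀ ⁆ i (R⊆D∖i₀ i r)
      proper : ∣ R ∣ < ∣ D ∣
      proper = ℕ.≤-trans (s≤s (∣∣-mono R⊆D∖i₀)) (ℕ.≤-reflexive (begin-equality
        suc ∣ D ∖ ⁅ i₀ ⁆ ∣           ≡⟨ ℕ.+-comm 1 _ ⟩
        ∣ D ∖ ⁅ i₀ ⁆ ∣ + 1           ≡⟨ cong (∣ D ∖ ⁅ i₀ ⁆ ∣ +_) (∣⁅⁆∣ i₀) ⟨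
        ∣ D ∖ ⁅ i₀ ⁆ ∣ + ∣ ⁅ i₀ ⁆ ∣  ≡⟨ ∣∖∣+∣∣ {S = D} ⁅i₀⁆⊆D ⟩
        ∣ D ∣                        ∎))

  hall : ∀ n → Solvable n
  hall n D A size hallD with Fin.any? (T? ∘ D)
  ... | no empty = emptyMatching (λ i d → empty (i , d))
  hall zero D A size hallD | yes (i₀ , d₀) = contradiction (ℕ.≤-trans (member⇒1≤∣∣ i₀ d₀) size) λ ()
  hall (suc n) D A size hallD | yes (i₀ , d₀) with anySubset? critical-resp (critical? D A)
  ... | yes (S , critical) = splitCritical n (hall n) size hallD S critical
  ... | no noCritical = removeEdge n (hall n) size hallD i₀ d₀ (λ S c → noCritical (S , c))

  hallsTheorem : (∀ S → ∣ S ∣ ≤ ∣ Γ⟨ S ⟩ ∣) →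
                 Σ (Fin p → Fin q) λ f → (∀ i → T (E i (f i))) × Injective _≡_ _≡_ f
  hallsTheorem hallCond =
    (λ i → partner i _) , (λ i → edge i _) , λ {i} {j} → injective i j _ _
    where
    hallFull : HallCondition full full
    hallFull S _ = ℕ.≤-trans (hallCond S) (∣∣-mono {S = Γ⟨ S ⟩} (λ c p → ∩-intro p _))
    open Matching (hall p full full (ℕ.≤-reflexive (∣full∣ p)) hallFull)

-- An injective map Fin n → Fin n is surjective: a missed value would yield an
-- injection Fin n → Fin (n - 1).
injective⇒surjective : ∀ {n} {f : Fin n → Fin n} → Injective _≡_ _≡_ f → ∀ j → ∃ λ i → f i ≡ j
injective⇒surjective {suc n} {f} f-inj j with Fin.any? (λ i → f i Fin.≟ j)
... | yes hit = hit
... | no missed = contradiction (Fin.injective⇒≤ squeeze-injective) ℕ.1+n≰n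
  where
  j≢f : ∀ i → j ≢ f i
  j≢f i eq = missed (i , sym eq)
  squeeze : Fin (suc n) → Fin n
  squeeze i = punchOut (j≢f i)
  squeeze-injective : Injective _≡_ _≡_ squeeze
  squeeze-injective eq = f-inj (Fin.punchOut-injective (j≢f _) (j≢f _) eq)

splitAt-injective : ∀ m {n} {i j : Fin (m + n)} → splitAt m i ≡ splitAt m j → i ≡ j
splitAt-injective m {n} {i} {j} eq =
  trans (sym (Fin.join-splitAt m n i)) (trans (cong (join m n) eq) (Fin.join-splitAt m n j))

𝟙-∧ : ∀ x y → 𝟙 (x ∧ y) ≡ 𝟙 x * 𝟙 y
𝟙-∧ true y = sym (ℕ.+-identityʳ (𝟙 y))
𝟙-∧ false y = refl

∣∧∣ : ∀ {n} x (S : Subset n) → ∑[ j < n ] 𝟙 (x ∧ S j) ≡ 𝟙 x * ∣ S ∣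
∣∧∣ x S = trans (sum-cong-≗ (λ j → 𝟙-∧ x (S j))) (sym (*-distribˡ-sum (𝟙 x) (𝟙 ∘ S)))

chosenColour : ∀ {a d} k → a ≤ d → a + k * 1 ≤ k * 1 + (d + 0)
chosenColour {a} {d} k a≤d rewrite ℕ.+-identityʳ d =
  ℕ.≤-trans (ℕ.≤-reflexive (ℕ.+-comm a (k * 1))) (ℕ.+-monoʳ-≤ (k * 1) a≤d)

-- The pointwise inequality behind the double counting below, for one colour of
-- degree d ≤ k which receives a ≤ d edges from chosen vertices; x says that the
-- colour is reached by a chosen vertex (otherwise a = 0), y that it is chosen itself.
perColour : ∀ {a d k} x y → a ≤ d → d ≤ k → (¬ T x → a ≡ 0) →
            a + k * 𝟙 y ≤ k * 𝟙 (x ∨ (y ∧ ⌊ d <? k ⌋)) + 𝟙 y * d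
perColour {a} {d} {k} true false a≤d d≤k _
  rewrite ℕ.*-zeroʳ k | ℕ.+-identityʳ a | ℕ.*-identityʳ k | ℕ.+-identityʳ k = ℕ.≤-trans a≤d d≤k
perColour {k = k} false false _ _ unreached rewrite unreached (λ ()) | ℕ.*-zeroʳ k = z≤n
perColour {d = d} {k} x true a≤d _ unreached with d <? k | x
... | yes _ | x rewrite ∨-zeroʳ x = chosenColour k a≤d
... | no _ | true = chosenColour k a≤d
... | no d≮k | false rewrite unreached (λ ()) | ℕ.*-identityʳ k | ℕ.*-zeroʳ k | ℕ.+-identityʳ d = ℕ.≮⇒≥ d≮k

column : ∀ {N B} → (Fin N → Fin B → Bool) → Fin B → Subset N
column I c v = I v c

SaturatingMatching : ∀ {N B} → (Fin N → Fin B → Bool) → ℕ → Set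
SaturatingMatching {N} {B} I k =
  Σ (Fin N → Fin B) λ g → (∀ v → T (I v (g v))) × Injective _≡_ _≡_ g ×
                           (∀ c → ∣ column I c ∣ ≡ k → ∃ λ v → g v ≡ c)

module DegreeBounded {N B k : ℕ} .{{_ : NonZero k}} (I : Fin N → Fin B → Bool)
  (rowDegree : ∀ v → ∣ I v ∣ ≡ k) (columnDegree : ∀ c → ∣ column I c ∣ ≤ k) where

  open Hall I using () renaming (Γ⟨_⟩ to colours⟨_⟩; Γ-elim to colours-elim)
  open Hall (λ c v → I v c) using () renaming (Γ⟨_⟩ to vertices⟨_⟩; Γ-elim to vertices-elim)

  sparse : Subset B
  sparse c = ⌊ ∣ column I c ∣ <? k ⌋

  edgesFrom : ∀ SV → ∑[ c < B ] ∣ SV ∩ column I c ∣ ≡ k * ∣ SV ∣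
  edgesFrom SV = begin
    ∑[ c < B ] ∑[ v < N ] 𝟙 (SV v ∧ I v c)  ≡⟨ ∑-comm (λ c v → 𝟙 (SV v ∧ I v c)) ⟩
    ∑[ v < N ] ∑[ c < B ] 𝟙 (SV v ∧ I v c)  ≡⟨ sum-cong-≗ (λ v → ∣∧∣ (SV v) (I v)) ⟩
    ∑[ v < N ] (𝟙 (SV v) * ∣ I v ∣)
      ≡⟨ sum-cong-≗ (λ v → trans (cong (𝟙 (SV v) *_) (rowDegree v)) (ℕ.*-comm _ k)) ⟩
    ∑[ v < N ] (k * 𝟙 (SV v))                 ≡⟨ *-distribˡ-sum k (𝟙 ∘ SV) ⟨
    k * ∣ SV ∣                               ∎
    where open ≡-Reasoning

  -- The edges at a colour set SC all end in its neighbourhood, whose vertices have degree k.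
  edgesInto : ∀ SC → ∑[ c < B ] (𝟙 (SC c) * ∣ column I c ∣) ≤ k * ∣ vertices⟨ SC ⟩ ∣
  edgesInto SC = begin
    ∑[ c < B ] (𝟙 (SC c) * ∣ column I c ∣)     ≡⟨ sum-cong-≗ (λ c → ∣∧∣ (SC c) (column I c)) ⟨
    ∑[ c < B ] ∑[ v < N ] 𝟙 (SC c ∧ I v c)  ≡⟨ ∑-comm (λ c v → 𝟙 (SC c ∧ I v c)) ⟩
    ∑[ v < N ] ∣ SC ∩ I v ∣                 ≤⟨ ∑-mono atVertex ⟩
    ∑[ v < N ] (k * 𝟙 (vertices⟨ SC ⟩ v))      ≡⟨ *-distribˡ-sum k (𝟙 ∘ vertices⟨ SC ⟩) ⟨
    k * ∣ vertices⟨ SC ⟩ ∣                   ∎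
    where
    open ℕ.≤-Reasoning
    atVertex : ∀ v → ∣ SC ∩ I v ∣ ≤ k * 𝟙 (vertices⟨ SC ⟩ v)
    atVertex v with T? (vertices⟨ SC ⟩ v)
    ... | yes reached = begin
      ∣ SC ∩ I v ∣                    ≤⟨ ∣∣-mono (∩-⊆ʳ SC (I v)) ⟩
      ∣ I v ∣                         ≡⟨ rowDegree v ⟩
      k                               ≡⟨ ℕ.*-identityʳ k ⟨
      k * 1                           ≡⟨ cong (k *_) (𝟙-true reached) ⟨
      k * 𝟙 (vertices⟨ SC ⟩ v)        ∎
    ... | no unreached = begin
      ∣ SC ∩ I v ∣                    ≡⟨ ∣∣-empty {S = SC ∩ I v} unreached ⟩
      0                               ≡⟨ ℕ.*-zeroʳ k ⟨
      k * 0                           ≡⟨ cong (k *_) (𝟙-false unreached) ⟨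
      k * 𝟙 (vertices⟨ SC ⟩ v)        ∎

  doubleCounting : ∀ SV SC → ∣ SV ∣ + ∣ SC ∣ ≤ ∣ colours⟨ SV ⟩ ∪ (SC ∩ sparse) ∣ + ∣ vertices⟨ SC ⟩ ∣
  doubleCounting SV SC = ℕ.*-cancelˡ-≤ k (begin
    k * (∣ SV ∣ + ∣ SC ∣)
      ≡⟨ ℕ.*-distribˡ-+ k ∣ SV ∣ ∣ SC ∣ ⟩
    k * ∣ SV ∣ + k * ∣ SC ∣
      ≡⟨ cong₂ _+_ (sym (edgesFrom SV)) (*-distribˡ-sum k (𝟙 ∘ SC)) ⟩
    ∑[ c < B ] ∣ SV ∩ column I c ∣ + ∑[ c < B ] (k * 𝟙 (SC c))
      ≡⟨ ∑-distrib-+ (λ c → ∣ SV ∩ column I c ∣) (λ c → k * 𝟙 (SC c)) ⟨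
    ∑[ c < B ] (∣ SV ∩ column I c ∣ + k * 𝟙 (SC c))
      ≤⟨ ∑-mono atColour ⟩
    ∑[ c < B ] (k * 𝟙 (A c) + 𝟙 (SC c) * ∣ column I c ∣)
      ≡⟨ ∑-distrib-+ (λ c → k * 𝟙 (A c)) (λ c → 𝟙 (SC c) * ∣ column I c ∣) ⟩
    ∑[ c < B ] (k * 𝟙 (A c)) + ∑[ c < B ] (𝟙 (SC c) * ∣ column I c ∣)
      ≤⟨ ℕ.+-mono-≤ (ℕ.≤-reflexive (sym (*-distribˡ-sum k (𝟙 ∘ A)))) (edgesInto SC) ⟩
    k * ∣ A ∣ + k * ∣ vertices⟨ SC ⟩ ∣
      ≡⟨ ℕ.*-distribˡ-+ k ∣ A ∣ _ ⟨
    k * (∣ A ∣ + ∣ vertices⟨ SC ⟩ ∣) ∎)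
    where
    open ℕ.≤-Reasoning
    A : Subset B
    A = colours⟨ SV ⟩ ∪ (SC ∩ sparse)
    atColour : ∀ c → ∣ SV ∩ column I c ∣ + k * 𝟙 (SC c) ≤ k * 𝟙 (A c) + 𝟙 (SC c) * ∣ column I c ∣
    atColour c = perColour (colours⟨ SV ⟩ c) (SC c) (∣∣-mono (∩-⊆ʳ SV (column I c))) (columnDegree c)
                   (∣∣-empty {S = SV ∩ column I c})

  link : Fin N ⊎ Fin B → Fin N ⊎ Fin B → Bool
  link (inj₁ v) (inj₁ w) = false
  link (inj₁ v) (inj₂ c) = I v c
  link (inj₂ c) (inj₁ w) = I w c
  link (inj₂ c) (inj₂ c′) = ⁅ c ⁆ c′ ∧ sparse c

  square : Fin (N + B) → Fin (N + B) → Bool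
  square x y = link (splitAt N x) (splitAt N y)

  square-join : ∀ x y → square (join N B x) (join N B y) ≡ link x y
  square-join x y = cong₂ link (Fin.splitAt-join N B x) (Fin.splitAt-join N B y)

  open Hall square using (hallsTheorem) renaming (Γ⟨_⟩ to □⟨_⟩; Γ-intro to □-intro)

  squareHall : ∀ S → ∣ S ∣ ≤ ∣ □⟨ S ⟩ ∣
  squareHall S = begin
    ∣ S ∣
      ≡⟨ ∑-++ N (𝟙 ∘ S) ⟩
    ∣ SV ∣ + ∣ SC ∣
      ≤⟨ doubleCounting SV SC ⟩
    ∣ colours⟨ SV ⟩ ∪ (SC ∩ sparse) ∣ + ∣ vertices⟨ SC ⟩ ∣
      ≤⟨ ℕ.+-mono-≤ (∣∣-mono coloursReached) (∣∣-mono verticesReached) ⟩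
    ∣ □⟨ S ⟩ ∘ (N ↑ʳ_) ∣ + ∣ □⟨ S ⟩ ∘ (_↑ˡ B) ∣
      ≡⟨ ℕ.+-comm ∣ □⟨ S ⟩ ∘ (N ↑ʳ_) ∣ _ ⟩
    ∣ □⟨ S ⟩ ∘ (_↑ˡ B) ∣ + ∣ □⟨ S ⟩ ∘ (N ↑ʳ_) ∣
      ≡⟨ ∑-++ N (𝟙 ∘ □⟨ S ⟩) ⟨
    ∣ □⟨ S ⟩ ∣ ∎
    where
    open ℕ.≤-Reasoning
    SV : Subset N
    SV v = S (v ↑ˡ B)
    SC : Subset B
    SC c = S (N ↑ʳ c)
    coloursReached : colours⟨ SV ⟩ ∪ (SC ∩ sparse) ⊆ □⟨ S ⟩ ∘ (N ↑ʳ_)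
    coloursReached c p with ∪-elim p
    ... | inj₁ reached with colours-elim reached
    ...   | v , sv , e = □-intro sv (subst T (sym (square-join (inj₁ v) (inj₂ c))) e)
    coloursReached c p | inj₂ chosen with ∩-elim {SC c} chosen
    ... | sc , sp = □-intro sc (subst T (sym (square-join (inj₂ c) (inj₂ c))) (∩-intro (⁅⁆-intro c) sp))
    verticesReached : vertices⟨ SC ⟩ ⊆ □⟨ S ⟩ ∘ (_↑ˡ B)
    verticesReached v reached with vertices-elim reached
    ... | c , sc , e = □-intro sc (subst T (sym (square-join (inj₂ c) (inj₁ v))) e)

  -- A perfect matching of the square graph (kept abstract: only its stated properties matter).
  private abstract
    perfect : Σ (Fin (N + B) → Fin (N + B)) λ f → (∀ x → T (square x (f x))) × Injective _≡_ _≡_ f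
    perfect = hallsTheorem squareHall

    f : Fin (N + B) → Fin (N + B)
    f = proj₁ perfect

    f-edge : ∀ x → T (square x (f x))
    f-edge = proj₁ (proj₂ perfect)

    f-injective : Injective _≡_ _≡_ f
    f-injective = proj₂ (proj₂ perfect)

  vertexPartner : ∀ v → ∃ λ c → splitAt N (f (v ↑ˡ B)) ≡ inj₂ c × T (I v c)
  vertexPartner v = fromVertex (splitAt N (f (v ↑ˡ B))) edge
    where
    edge : T (link (inj₁ v) (splitAt N (f (v ↑ˡ B))))
    edge = subst (λ x → T (link x (splitAt N (f (v ↑ˡ B))))) (Fin.splitAt-↑ˡ N v B) (f-edge (v ↑ˡ B))
    fromVertex : ∀ y → T (link (inj₁ v) y) → ∃ λ c → y ≡ inj₂ c × T (I v c)
    fromVertex (inj₂ c) e = c , refl , e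

  matchColour : Fin N → Fin B
  matchColour v = proj₁ (vertexPartner v)

  matchColour-edge : ∀ v → T (I v (matchColour v))
  matchColour-edge v = proj₂ (proj₂ (vertexPartner v))

  matchColour-injective : Injective _≡_ _≡_ matchColour
  matchColour-injective {v} {w} eq = Fin.↑ˡ-injective B v w (f-injective (splitAt-injective N (begin
    splitAt N (f (v ↑ˡ B))   ≡⟨ proj₁ (proj₂ (vertexPartner v)) ⟩
    inj₂ (matchColour v)     ≡⟨ cong inj₂ eq ⟩
    inj₂ (matchColour w)     ≡⟨ proj₁ (proj₂ (vertexPartner w)) ⟨
    splitAt N (f (w ↑ˡ B))   ∎)))
    where open ≡-Reasoning

  denseUnlinked : ∀ {c} c′ → ¬ T (sparse c) → ¬ T (link (inj₂ c′) (inj₂ c))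
  denseUnlinked {c} c′ dense linked with ∩-elim {⁅ c′ ⁆ c} linked
  ... | c≡c′ , sparse-c′ = dense (subst (T ∘ sparse) (sym (⁅⁆-elim c≡c′)) sparse-c′)

  -- A colour that is not sparse is matched to a vertex: its left copy could only
  -- be matched to itself, which the square graph forbids for such colours.
  denseColoursUsed : ∀ c → ¬ T (sparse c) → ∃ λ v → matchColour v ≡ c
  denseColoursUsed c dense with injective⇒surjective f-injective (N ↑ʳ c)
  ... | i , fi≡c with splitAt N i in i-side | f-edge i
  ... | inj₁ v | _ = v , inj₂-injective (begin
    inj₂ (matchColour v)     ≡⟨ proj₁ (proj₂ (vertexPartner v)) ⟨
    splitAt N (f (v ↑ˡ B))   ≡⟨ cong (splitAt N ∘ f) (Fin.splitAt⁻¹-↑ˡ i-side) ⟩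
    splitAt N (f i)          ≡⟨ cong (splitAt N) fi≡c ⟩
    splitAt N (N ↑ʳ c)       ≡⟨ Fin.splitAt-↑ʳ N B c ⟩
    inj₂ c                   ∎)
    where open ≡-Reasoning
  ... | inj₂ c′ | e = contradiction
    (subst (T ∘ link (inj₂ c′)) (trans (cong (splitAt N) fi≡c) (Fin.splitAt-↑ʳ N B c)) e)
    (denseUnlinked c′ dense)

  saturatingMatching : SaturatingMatching I k
  saturatingMatching = matchColour , matchColour-edge , matchColour-injective ,
    λ c deg≡k → denseColoursUsed c (λ sp → ℕ.<-irrefl deg≡k (toWitness sp))

⌈d/k⌉≡1 : ∀ {d k} .{{_ : NonZero k}} → 1 ≤ d → d < k → ⌈ d / k ⌉ ≡ 1
⌈d/k⌉≡1 {suc d} {suc k} (s≤s _) (s≤s d<k) = begin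
  (suc d + k) / suc k          ≡⟨ m/n≡1+[m∸n]/n (s≤s (ℕ.m≤n+m k d)) ⟩
  suc ((d + k ∸ k) / suc k)    ≡⟨ cong (λ x → suc (x / suc k)) (ℕ.m+n∸n≡m d k) ⟩
  suc (d / suc k)              ≡⟨ cong suc (m<n⇒m/n≡0 (ℕ.m≤n⇒m≤1+n d<k)) ⟩
  1                            ∎
  where open ≡-Reasoning

proportionalUse : ∀ {x d k} .{{_ : NonZero k}} → 1 ≤ d → d ≤ k → x ≤ 1 → (d ≡ k → x ≡ 1) →
                  x ≡ d / k ⊎ x ≡ ⌈ d / k ⌉
proportionalUse {x} {d} {k} 1≤d d≤k x≤1 onceIfFull with ℕ.m≤n⇒m<n∨m≡n d≤k
... | inj₂ refl = inj₁ (trans (onceIfFull refl) (sym (n/n≡1 d)))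
... | inj₁ d<k with x≤1
...   | z≤n = inj₁ (sym (m<n⇒m/n≡0 d<k))
...   | s≤s z≤n = inj₂ (sym (⌈d/k⌉≡1 1≤d d<k))

module _ {N B : ℕ} {g : Fin N → Fin B} (g-injective : Injective _≡_ _≡_ g) where

  ∣fibre∣≡1 : ∀ {c i} → g i ≡ c → ∣ ⁅ c ⁆ ∘ g ∣ ≡ 1
  ∣fibre∣≡1 {c} {i} gi≡c = trans (∣∣-cong fibre⊆⁅i⁆ ⁅i⁆⊆fibre) (∣⁅⁆∣ i)
    where
    fibre⊆⁅i⁆ : ⁅ c ⁆ ∘ g ⊆ ⁅ i ⁆
    fibre⊆⁅i⁆ j p = fromWitness (g-injective (trans (⁅⁆-elim p) (sym gi≡c)))
    ⁅i⁆⊆fibre : ⁅ i ⁆ ⊆ ⁅ c ⁆ ∘ g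
    ⁅i⁆⊆fibre j p = fromWitness (trans (cong g (⁅⁆-elim p)) gi≡c)

  ∣fibre∣≤1 : ∀ c → ∣ ⁅ c ⁆ ∘ g ∣ ≤ 1
  ∣fibre∣≤1 c with T? (⋁ (⁅ c ⁆ ∘ g))
  ... | yes hit = ℕ.≤-reflexive (∣fibre∣≡1 (⁅⁆-elim (proj₂ (⋁-elim hit))))
  ... | no missed = ℕ.≤-trans (ℕ.≤-reflexive (∣∣-empty missed)) z≤n

length-filter-tabulate : ∀ {A : Set} {P : A → Set} (P? : Decidable P) {n} (h : Fin n → A) →
  length (filter P? (tabulate h)) ≡ ∣ (λ i → ⌊ P? (h i) ⌋) ∣
length-filter-tabulate P? {zero} h = refl
length-filter-tabulate P? {suc n} h with P? (h zero)
... | yes _ = cong suc (length-filter-tabulate P? (h ∘ suc))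
... | no _ = length-filter-tabulate P? (h ∘ suc)

countVertices : ∀ n m {P : Vertex n m → Set} (P? : Decidable P) →
  length (filter P? (vertices n m)) ≡ ∣ (λ i → ⌊ P? (splitAt n i) ⌋) ∣
countVertices n m P? = begin
  length (filter P? (vertices n m))
    ≡⟨ cong length (List.filter-++ P? (map inj₁ (tabulate id)) _) ⟩
  length (filter P? (map inj₁ (tabulate id)) ++ filter P? (map inj₂ (tabulate id)))
    ≡⟨ List.length-++ (filter P? (map inj₁ (tabulate id))) ⟩
  length (filter P? (map inj₁ (tabulate id))) + length (filter P? (map inj₂ (tabulate id)))
    ≡⟨ cong₂ (λ xs ys → length (filter P? xs) + length (filter P? ys))
             (List.map-tabulate id inj₁) (List.map-tabulate id inj₂) ⟩
  length (filter P? (tabulate inj₁)) + length (filter P? (tabulate inj₂))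
    ≡⟨ cong₂ _+_ (length-filter-tabulate P? inj₁) (length-filter-tabulate P? inj₂) ⟩
  ∑[ i < n ] 𝟙 ⌊ P? (inj₁ i) ⌋ + ∑[ j < m ] 𝟙 ⌊ P? (inj₂ j) ⌋
    ≡⟨ cong₂ _+_ (sum-cong-≗ (λ i → cong (λ x → 𝟙 ⌊ P? x ⌋) (Fin.splitAt-↑ˡ n i m)))
                 (sum-cong-≗ (λ j → cong (λ x → 𝟙 ⌊ P? x ⌋) (Fin.splitAt-↑ʳ n m j))) ⟨
  ∑[ i < n ] 𝟙 ⌊ P? (splitAt n (i ↑ˡ m)) ⌋ + ∑[ j < m ] 𝟙 ⌊ P? (splitAt n (n ↑ʳ j)) ⌋
    ≡⟨ ∑-++ n (λ i → 𝟙 ⌊ P? (splitAt n i) ⌋) ⟨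
  ∣ (λ i → ⌊ P? (splitAt n i) ⌋) ∣ ∎
  where open ≡-Reasoning

∈⇒≤sum : ∀ {c xs} → c ∈ xs → c ≤ ListAction.sum xs
∈⇒≤sum (here refl) = ℕ.m≤m+n _ _
∈⇒≤sum {xs = x ∷ _} (there c∈xs) = ℕ.≤-trans (∈⇒≤sum c∈xs) (ℕ.m≤n+m _ x)

listed : ∀ B → List ℕ → Subset B
listed B ys c = ⌊ toℕ c ∈? ys ⌋

∣listed∣ : ∀ {B} xs → Unique xs → (∀ c → c ∈ xs → c < B) → ∣ listed B xs ∣ ≡ length xs
∣listed∣ {B} [] _ _ = ∑-zero (𝟙 ∘ listed B []) (λ _ → refl)
∣listed∣ {B} (x ∷ xs) (x∉xs ∷ unique) bounded = begin
  ∣ listed B (x ∷ xs) ∣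
    ≡⟨ ∣∣-cong split merge ⟩
  ∣ ⁅ x′ ⁆ ∪ listed B xs ∣
    ≡⟨ ∣∪∣-disjoint {S = ⁅ x′ ⁆} disjoint ⟩
  ∣ ⁅ x′ ⁆ ∣ + ∣ listed B xs ∣
    ≡⟨ cong₂ _+_ (∣⁅⁆∣ x′) (∣listed∣ xs unique (λ c → bounded c ∘ there)) ⟩
  suc (length xs) ∎
  where
  open ≡-Reasoning
  x′ : Fin B
  x′ = fromℕ< (bounded x (here refl))
  is-x′ : ∀ {c} → T (⁅ x′ ⁆ c) → toℕ c ≡ x
  is-x′ c≡x′ = trans (cong toℕ (⁅⁆-elim c≡x′)) (Fin.toℕ-fromℕ< _)
  split : listed B (x ∷ xs) ⊆ ⁅ x′ ⁆ ∪ listed B xs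
  split c p with toWitness p
  ... | here eq =
    ∪-introˡ {y = listed B xs c} (fromWitness (Fin.toℕ-injective (trans eq (sym (Fin.toℕ-fromℕ< _)))))
  ... | there c∈xs = ∪-introʳ {⁅ x′ ⁆ c} (fromWitness c∈xs)
  merge : ⁅ x′ ⁆ ∪ listed B xs ⊆ listed B (x ∷ xs)
  merge c p with ∪-elim p
  ... | inj₁ c≡x′ = fromWitness (here (is-x′ c≡x′))
  ... | inj₂ c∈xs = fromWitness (there (toWitness c∈xs))
  disjoint : ∀ c → T (⁅ x′ ⁆ c) → T (listed B xs c) → ⊥
  disjoint c c≡x′ c∈xs = All.lookup x∉xs (toWitness c∈xs) (sym (is-x′ c≡x′))

Adj-irreflexive : ∀ {n m} (v : Vertex n m) → ¬ Adj v v
Adj-irreflexive (inj₁ _) ()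
Adj-irreflexive (inj₂ _) ()

-- The list assignment L on K_{n,m} as an incidence matrix between Fin (n + m),
-- indexing the vertices, and Fin B, where B exceeds every listed colour.
module Encoding {n m : ℕ} (L : ListAssignment n m) where

  vertex : Fin (n + m) → Vertex n m
  vertex = splitAt n

  index : Vertex n m → Fin (n + m)
  index = join n m

  -- A bound on all listed colours, so that they can be indexed by Fin B.
  B : ℕ
  B = suc (∑[ i < n + m ] ListAction.sum (L (vertex i)))

  listed<B : ∀ {v c} → c ∈ L v → c < B
  listed<B {v} {c} c∈Lv = s≤s (begin
    c                                 ≤⟨ ∈⇒≤sum c∈Lv ⟩
    ListAction.sum (L v)                    ≡⟨ cong (ListAction.sum ∘ L) (Fin.splitAt-join n m v) ⟨
    ListAction.sum (L (vertex (index v)))   ≤⟨ term≤∑ (ListAction.sum ∘ L ∘ vertex) (index v) ⟩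
    ∑[ i < n + m ] ListAction.sum (L (vertex i)) ∎)
    where open ℕ.≤-Reasoning

  I : Fin (n + m) → Fin B → Bool
  I i = listed B (L (vertex i))

  η≡∣column∣ : ∀ c → η L (toℕ c) ≡ ∣ column I c ∣
  η≡∣column∣ c = countVertices n m (λ v → toℕ c ∈? L v)

  -- The degree conditions of DegreeBounded: rows from the k-assignment, columns from
  -- the bound on η (colours outside the palette have empty columns).
  rowDegree : ∀ {k} → IsKAssignment k L → ∀ i → ∣ I i ∣ ≡ k
  rowDegree kAssignment i =
    trans (∣listed∣ (L (vertex i)) (proj₁ (kAssignment (vertex i))) (λ c → listed<B))
          (proj₂ (kAssignment (vertex i)))

  columnDegree : ∀ {k} → (∀ c → InPalette L c → η L c ≤ k) → ∀ c → ∣ column I c ∣ ≤ k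
  columnDegree bounded c with T? (⋁ (column I c))
  ... | yes used with ⋁-elim used
  ...   | i , c∈Li = subst (_≤ _) (η≡∣column∣ c) (bounded (toℕ c) (vertex i , toWitness c∈Li))
  columnDegree bounded c | no unused = ℕ.≤-trans (ℕ.≤-reflexive (∣∣-empty unused)) z≤n

  colouring : (Fin (n + m) → Fin B) → Vertex n m → Color
  colouring g v = toℕ (g (index v))

  colouring-injective : ∀ {g} → Injective _≡_ _≡_ g → Injective _≡_ _≡_ (colouring g)
  colouring-injective {g} g-injective {u} {v} eq = begin
    u                        ≡⟨ Fin.splitAt-join n m u ⟨
    vertex (index u)         ≡⟨ cong vertex (g-injective (Fin.toℕ-injective eq)) ⟩
    vertex (index v)         ≡⟨ Fin.splitAt-join n m v ⟩
    v                        ∎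
    where open ≡-Reasoning

  preimage≡fibre : ∀ g c → preimageSize (colouring g) (toℕ c) ≡ ∣ ⁅ c ⁆ ∘ g ∣
  preimage≡fibre g c =
    trans (countVertices n m (λ v → colouring g v ℕ.≟ toℕ c)) (∣∣-cong toFibre fromFibre)
    where
    toFibre : (λ i → ⌊ colouring g (vertex i) ℕ.≟ toℕ c ⌋) ⊆ ⁅ c ⁆ ∘ g
    toFibre i p =
      fromWitness (Fin.toℕ-injective (trans (cong (toℕ ∘ g) (sym (Fin.join-splitAt n m i))) (toWitness p)))
    fromFibre : ⁅ c ⁆ ∘ g ⊆ (λ i → ⌊ colouring g (vertex i) ℕ.≟ toℕ c ⌋)
    fromFibre i p = fromWitness (trans (cong (toℕ ∘ g) (Fin.join-splitAt n m i)) (cong toℕ (⁅⁆-elim p)))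

  proportional : ∀ {k} .{{_ : NonZero k}} {g} → Injective _≡_ _≡_ g →
    (∀ c → ∣ column I c ∣ ≡ k → ∃ λ i → g i ≡ c) → (∀ c → InPalette L c → η L c ≤ k) →
    ∀ c → InPalette L c →
    preimageSize (colouring g) c ≡ η L c / k ⊎ preimageSize (colouring g) c ≡ ⌈ η L c / k ⌉
  proportional {k} {g} g-injective covers bounded c (v , c∈Lv) =
    subst Proportional (Fin.toℕ-fromℕ< (listed<B c∈Lv))
      (proportionalUse used (bounded _ (v , c′∈Lv)) atMostOnce onceIfFull)
    where
    Proportional : ℕ → Set
    Proportional x = preimageSize (colouring g) x ≡ η L x / k ⊎ preimageSize (colouring g) x ≡ ⌈ η L x / k ⌉
    c′ : Fin B
    c′ = fromℕ< (listed<B c∈Lv)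
    c′∈Lv : toℕ c′ ∈ L v
    c′∈Lv = subst (_∈ L v) (sym (Fin.toℕ-fromℕ< _)) c∈Lv
    used : 1 ≤ η L (toℕ c′)
    used = subst (1 ≤_) (sym (η≡∣column∣ c′)) (member⇒1≤∣∣ {S = column I c′} (index v) (fromWitness c′∈L))
      where
      c′∈L : toℕ c′ ∈ L (vertex (index v))
      c′∈L = subst (λ u → toℕ c′ ∈ L u) (sym (Fin.splitAt-join n m v)) c′∈Lv
    atMostOnce : preimageSize (colouring g) (toℕ c′) ≤ 1
    atMostOnce = subst (_≤ 1) (sym (preimage≡fibre g c′)) (∣fibre∣≤1 g-injective c′)
    onceIfFull : η L (toℕ c′) ≡ k → preimageSize (colouring g) (toℕ c′) ≡ 1
    onceIfFull η≡k with covers c′ (trans (sym (η≡∣column∣ c′)) η≡k)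
    ... | i , gi≡c′ = trans (preimage≡fibre g c′) (∣fibre∣≡1 g-injective gi≡c′)

  proportionalColouring : ∀ {k} .{{_ : NonZero k}} → (∀ c → InPalette L c → η L c ≤ k) →
                          SaturatingMatching I k → ∃ λ f → IsProportionalLColoring k L f
  proportionalColouring bounded (g , g-edge , g-injective , covers) =
    colouring g , (fromLists , proper) , proportional g-injective covers bounded
    where
    fromLists : ∀ v → colouring g v ∈ L v
    fromLists v = subst (λ u → colouring g v ∈ L u) (Fin.splitAt-join n m v) (toWitness (g-edge (index v)))
    proper : ∀ u v → Adj u v → colouring g u ≢ colouring g v
    proper u v adj eq = Adj-irreflexive v (subst (λ w → Adj w v) (colouring-injective g-injective eq) adj)

corollary17 : (n m k : ℕ) → .{{_ : NonZero n}} → .{{_ : NonZero m}} → .{{_ : NonZero k}} →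
    (L : ListAssignment n m) → IsKAssignment k L →
    (∀ c → InPalette L c → η L c ≤ k) →
    ∃ λ f → IsProportionalLColoring k L f
corollary17 n m k L kAssignment bounded =
  proportionalColouring bounded (saturatingMatching I (rowDegree kAssignment) (columnDegree bounded))
  where
  open Encoding L
  open DegreeBounded using (saturatingMatching)
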